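{- Assume the following statement (Conjecture 2): for every positive integer $n$ and every system $\mathcal{S} \subseteq G_n$, if $\mathcal{S}$ has only finitely many solutions in non-negative rationals $x_1,\ldots,x_n$, then each such solution satisfies $h(x_1,\ldots,x_n) \leqslant f(2n)$. If a Diophantine equation $D(x_1,\ldots,x_p)=0$ has only finitely many solutions in non-negative rationals, then an upper bound for their heights can be computed (from $D$).
   Context: The height of a rational number $\frac{p}{q}$ written in lowest terms is $h\left(\frac{p}{q}\right)=\max(|p|,|q|)$; the height of a rational tuple is $h(x_1,\ldots,x_n)=\max(h(x_1),\ldots,h(x_n))$. For a positive integer $n$, $G_n=\{x_i+1=x_k: i,k \in \{1,\ldots,n\}\} \cup \{x_i \cdot x_j=x_k: i,j,k \in \{1,\ldots,n\}\}$. The function $f$ is defined by $f(1)=1$ and $f(n+1)=2^{2^{f(n)}}$ for every positive integer $n$. A Diophantine equation is an equation $D(x_1,\ldots,x_p)=0$ with $D \in \mathbb{Z}[x_1,\ldots,x_p]$. -}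

module Defs where

open import Data.Nat using (ℕ; zero; suc; _⊔_; _^_; _≤_)
open import Data.Integer using (ℤ; ∣_∣)
open import Data.Rational using (ℚ; ↥_; ↧ₙ_; 0ℚ; 1ℚ; _+_; _*_; _/_)
import Data.Rational as Q
open import Data.Fin using (Fin; zero; suc)
open import Data.List using (List)
open import Data.List.Membership.Propositional using (_∈_)
open import Data.List.Relation.Unary.Any using (Any)
open import Data.List.Relation.Unary.All using (All)
open import Data.Product using (Σ; _×_)
open import Relation.Binary.PropositionalEquality using (_≡_)

-- height of a rational in lowest terms (ℚ of the stdlib is always normalised)
hℚ : ℚ → ℕ
hℚ x = ∣ ↥ x ∣ ⊔ ↧ₙ x

height : {n : ℕ} → (Fin n → ℚ) → ℕ
height {zero}  x = 0
height {suc n} x = hℚ (x zero) ⊔ height (λ i → x (suc i))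

-- f(1) = 1, f(n+1) = 2^(2^f(n)); the value f(0) is junk and never used
f : ℕ → ℕ
f zero = 0
f (suc zero) = 1
f (suc (suc n)) = 2 ^ (2 ^ f (suc n))

data GEq (n : ℕ) : Set where
  add1 : Fin n → Fin n → GEq n
  mul  : Fin n → Fin n → Fin n → GEq n

holds : {n : ℕ} → (Fin n → ℚ) → GEq n → Set
holds x (add1 i k)  = x i + 1ℚ ≡ x k
holds x (mul i j k) = x i * x j ≡ x k

System : ℕ → Set
System n = List (GEq n)

NonNegTuple : {n : ℕ} → (Fin n → ℚ) → Set
NonNegTuple {n} x = (i : Fin n) → 0ℚ Q.≤ x i

SolvesSys : {n : ℕ} → System n → (Fin n → ℚ) → Set
SolvesSys S x = NonNegTuple x × All (holds x) S

FinitelyMany : {n : ℕ} → ((Fin n → ℚ) → Set) → Set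
FinitelyMany {n} P =
  Σ (List (Fin n → ℚ)) λ L → (x : Fin n → ℚ) → P x → Any (λ y → (i : Fin n) → x i ≡ y i) L

Conjecture2 : Set
Conjecture2 = (n : ℕ) → 1 ≤ n → (S : System n) → FinitelyMany (SolvesSys S) →
  (x : Fin n → ℚ) → SolvesSys S x → height x ≤ f (2 Data.Nat.* n)

data Poly (p : ℕ) : Set where
  con  : ℤ → Poly p
  var  : Fin p → Poly p
  _⊕_  : Poly p → Poly p → Poly p
  _⊗_  : Poly p → Poly p → Poly p

eval : {p : ℕ} → Poly p → (Fin p → ℚ) → ℚ
eval (con c) x = c / 1
eval (var i) x = x i
eval (a ⊕ b) x = eval a x + eval b x
eval (a ⊗ b) x = eval a x * eval b x

SolvesDio : {p : ℕ} → Poly p → (Fin p → ℚ) → Set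
SolvesDio D x = NonNegTuple x × eval D x ≡ 0ℚ

-- Write D = P − N with P, N polynomials with natural coefficients. Over the
-- non-negative rationals, P(x) and N(x) can be computed by a straight-line
-- program of steps "introduce 0 and 1", "t = u + 1", "t = u · v" and "t = u + v",
-- and each step is defined by equations from G: 0 and 1 are the only solution of
-- u · u = u, z + 1 = u, and u + v is pinned down through w = u / (v + 1), which
-- satisfies w · (v + 1) = u and (v + 1) · (w + 1) = (u + v) + 1. Adding the
-- equation P · 1 = N yields a system S ⊆ G_n whose non-negative solutions are
-- exactly the runs of the program on the solutions of D. Hence S has finitely
-- many solutions when D does, Conjecture 2 bounds their heights by f(2n), and the
-- solutions of D are sub-tuples of them; n depends only on D.
module Submission where

open import Defs
open import Data.Nat using (ℕ; _≤_)
open import Data.Fin using (Fin)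
open import Data.Rational using (ℚ)
open import Data.Product using (Σ)

import Data.Nat as N
import Data.Nat.Properties as NP
import Data.Nat.Coprimality as Coprimality
open import Data.Integer as ℤ using (+_; -[1+_])
import Data.Integer.Properties as ZP
open import Data.Fin using (zero; suc; _↑ʳ_; _↑ˡ_; splitAt; #_)
open import Data.Fin.Properties using (nonZeroIndex)
open import Data.Rational as Q using (0ℚ; 1ℚ; _+_; _*_; _/_; -_; _-_)
import Data.Rational.Properties as QP
open import Data.Rational.Solver using (module +-*-Solver)
open import Algebra.Properties.Group QP.+-0-group using (∙-cancelʳ; x∙y⁻¹≈ε⇒x≈y; x≈y⇒x∙y⁻¹≈ε)
import Data.Vec.Functional as V
open import Data.Vec.Functional.Properties using (lookup-++ʳ; ++-cong)
open import Data.List as List using ([]; _∷_)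
open import Data.List.Relation.Unary.All as All using (All; []; _∷_)
import Data.List.Relation.Unary.All.Properties as AllP
import Data.List.Relation.Unary.Any as Any
import Data.List.Relation.Unary.Any.Properties as AnyP
open import Data.Product using (_×_; _,_; proj₁; proj₂; uncurry)
open import Data.Sum using (inj₁; inj₂)
open import Function using (_∘_)
open import Relation.Nullary using (yes; no; contradiction)
open import Relation.Binary.PropositionalEquality

open +-*-Solver using (solve; _:+_; _:*_; _:-_; :-_; _:=_; con)

private
  variable
    n m k p : ℕ

NonNeg : ℚ → Set
NonNeg q = 0ℚ Q.≤ q

nonNeg-0 : NonNeg 0ℚ
nonNeg-0 = QP.≤-refl

nonNeg-1 : NonNeg 1ℚ
nonNeg-1 = Q.*≤* (ℤ.+≤+ N.z≤n)

nonNeg-+ : ∀ {a b} → NonNeg a → NonNeg b → NonNeg (a + b)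
nonNeg-+ = QP.+-mono-≤

nonNeg-* : ∀ {a b} → NonNeg a → NonNeg b → NonNeg (a * b)
nonNeg-* {a} {b} 0≤a 0≤b = QP.nonNegative⁻¹ (a * b)
  {{QP.nonNeg*nonNeg⇒nonNeg a {{Q.nonNegative 0≤a}} b {{Q.nonNegative 0≤b}}}}

nonNeg⇒+1-pos : ∀ {a} → NonNeg a → 0ℚ Q.< a + 1ℚ
nonNeg⇒+1-pos 0≤a = QP.+-mono-≤-< 0≤a 0<1
  where
  0<1 : 0ℚ Q.< 1ℚ
  0<1 = Q.*<* (ℤ.+<+ (N.s≤s N.z≤n))

nonNeg⇒+1≢0 : ∀ {a} → NonNeg a → a + 1ℚ ≢ 0ℚ
nonNeg⇒+1≢0 0≤a a+1≡0 = QP.<⇒≢ (nonNeg⇒+1-pos 0≤a) (sym a+1≡0)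

+1-cancel : ∀ {a b} → a + 1ℚ ≡ b + 1ℚ → a ≡ b
+1-cancel {a} {b} = ∙-cancelʳ 1ℚ a b

-- + k / 1 is stuck on a gcd; normalize-coprime turns it into mkℚ (+ k) 0 _, on which _+_ computes.
fromℕ-suc : ∀ k → + N.suc k / 1 ≡ + k / 1 + 1ℚ
fromℕ-suc k rewrite QP.normalize-coprime {k} {0} (Coprimality.sym (Coprimality.1-coprimeTo k)) =
  QP./-cong {+ N.suc k} {1} {+ k ℤ.* + 1 ℤ.+ + 1 ℤ.* + 1}
    (trans (cong +_ (NP.+-comm 1 k)) (cong (ℤ._+ + 1) (sym (ZP.*-identityʳ (+ k))))) refl

-- A total reciprocal; its value at 0 is junk.
recip : ℚ → ℚ
recip q with q QP.≟ 0ℚ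
... | yes _   = 0ℚ
... | no q≢0 = Q.1/_ q {{Q.≢-nonZero q≢0}}

recip-inverseʳ : ∀ a {q} → q ≢ 0ℚ → a * recip q * q ≡ a
recip-inverseʳ a {q} q≢0 with q QP.≟ 0ℚ
... | yes q≡0 = contradiction q≡0 q≢0
... | no q≢0′ = begin
  a * Q.1/_ q {{nz}} * q    ≡⟨ QP.*-assoc a _ q ⟩
  a * (Q.1/_ q {{nz}} * q)  ≡⟨ cong (a *_) (QP.*-inverseˡ q {{nz}}) ⟩
  a * 1ℚ                    ≡⟨ QP.*-identityʳ a ⟩
  a                         ∎
  where
  open ≡-Reasoning
  nz = Q.≢-nonZero q≢0′

quotient-unique : ∀ {w q a} → q ≢ 0ℚ → w * q ≡ a → w ≡ a * recip q
quotient-unique {w} {q} q≢0 refl = begin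
  w                      ≡⟨ sym (recip-inverseʳ w q≢0) ⟩
  w * recip q * q        ≡⟨ solve 3 (λ w r q → w :* r :* q := w :* q :* r) refl w (recip q) q ⟩
  w * q * recip q        ∎
  where open ≡-Reasoning

quotient-nonNeg : ∀ {a q} → NonNeg a → NonNeg q → NonNeg (a * recip (q + 1ℚ))
quotient-nonNeg {a} {q} 0≤a 0≤q =
  QP.*-cancelʳ-≤-pos (q + 1ℚ) {{Q.positive (nonNeg⇒+1-pos 0≤q)}}
    (subst₂ Q._≤_ (sym (QP.*-zeroˡ (q + 1ℚ))) (sym (recip-inverseʳ a (nonNeg⇒+1≢0 0≤q))) 0≤a)

++-nonNeg : {u : Fin m → ℚ} {v : Fin n → ℚ} → NonNegTuple u → NonNegTuple v → NonNegTuple (u V.++ v)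
++-nonNeg {m} 0≤u 0≤v i with splitAt m i
... | inj₁ j = 0≤u j
... | inj₂ j = 0≤v j

rename : (Fin n → Fin m) → GEq n → GEq m
rename ρ (add1 i k)  = add1 (ρ i) (ρ k)
rename ρ (mul i j k) = mul (ρ i) (ρ j) (ρ k)

holds-rename⁺ : ∀ (ρ : Fin n → Fin m) {y} e → holds (y ∘ ρ) e → holds y (rename ρ e)
holds-rename⁺ ρ (add1 i k)  h = h
holds-rename⁺ ρ (mul i j k) h = h

holds-rename⁻ : ∀ (ρ : Fin n → Fin m) {y} e → holds y (rename ρ e) → holds (y ∘ ρ) e
holds-rename⁻ ρ (add1 i k)  h = h
holds-rename⁻ ρ (mul i j k) h = h

holds-cong : {y y′ : Fin n → ℚ} → y ≗ y′ → ∀ e → holds y e → holds y′ e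
holds-cong y≗y′ (add1 i k)  h = trans (sym (cong (_+ 1ℚ) (y≗y′ i))) (trans h (y≗y′ k))
holds-cong y≗y′ (mul i j k) h = trans (sym (cong₂ _*_ (y≗y′ i) (y≗y′ j))) (trans h (y≗y′ k))

-- Steps defining fresh variables by equations of G

data Step (n : ℕ) : Set where
  constants   : Step n
  succ        : Fin n → Step n
  times plus  : Fin n → Fin n → Step n

fresh : Step n → ℕ
fresh constants   = 2
fresh (succ _)    = 1
fresh (times _ _) = 1
fresh (plus _ _)  = 5

-- The fresh variables come first: their values, then the old tuple.
witness : (s : Step n) → (Fin n → ℚ) → Fin (fresh s) → ℚ
witness constants   v = 0ℚ V.∷ 1ℚ V.∷ V.[]
witness (succ i)    v = v i + 1ℚ V.∷ V.[]
witness (times i j) v = v i * v j V.∷ V.[]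
witness (plus i j)  v = x + y V.∷ x + y + 1ℚ V.∷ w + 1ℚ V.∷ w V.∷ y + 1ℚ V.∷ V.[]
  where
  x = v i
  y = v j
  w = x * recip (y + 1ℚ)

extend : (s : Step n) → (Fin n → ℚ) → Fin (fresh s N.+ n) → ℚ
extend s v = witness s v V.++ v

equations : (s : Step n) → System (fresh s N.+ n)
equations constants   = mul (suc zero) (suc zero) (suc zero) ∷ add1 zero (suc zero) ∷ []
equations (succ i)    = add1 (1 ↑ʳ i) zero ∷ []
equations (times i j) = mul (1 ↑ʳ i) (1 ↑ʳ j) zero ∷ []
equations {n} (plus i j) =
  add1 (5 ↑ʳ j) t₄ ∷ mul t₃ t₄ (5 ↑ʳ i) ∷ add1 t₃ t₂ ∷ mul t₄ t₂ t₁ ∷ add1 t₀ t₁ ∷ []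
  where
  t₀ t₁ t₂ t₃ t₄ : Fin (5 N.+ n)
  t₀ = # 0
  t₁ = # 1
  t₂ = # 2
  t₃ = # 3
  t₄ = # 4

extend-old : ∀ (s : Step n) v i → extend s v (fresh s ↑ʳ i) ≡ v i
extend-old s v = lookup-++ʳ (witness s v) v

witness-cong : ∀ (s : Step n) {v v′} → v ≗ v′ → witness s v ≗ witness s v′
witness-cong constants   v≗v′ k = refl
witness-cong (succ i)    v≗v′ k = cong (λ a → witness (succ {1} zero) (λ _ → a) k) (v≗v′ i)
witness-cong (times i j) v≗v′ k =
  cong₂ (λ a b → witness (times {2} zero (suc zero)) (a V.∷ b V.∷ V.[]) k) (v≗v′ i) (v≗v′ j)
witness-cong (plus i j)  v≗v′ k =
  cong₂ (λ a b → witness (plus {2} zero (suc zero)) (a V.∷ b V.∷ V.[]) k) (v≗v′ i) (v≗v′ j)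

extend-cong : ∀ (s : Step n) {v v′} → v ≗ v′ → extend s v ≗ extend s v′
extend-cong s {v} {v′} v≗v′ = ++-cong (witness s v) (witness s v′) (witness-cong s v≗v′) v≗v′

witness-nonNeg : ∀ (s : Step n) {v} → NonNegTuple v → NonNegTuple (witness s v)
witness-nonNeg constants   0≤v zero       = nonNeg-0
witness-nonNeg constants   0≤v (suc zero) = nonNeg-1
witness-nonNeg (succ i)    0≤v zero = nonNeg-+ (0≤v i) nonNeg-1
witness-nonNeg (times i j) 0≤v zero = nonNeg-* (0≤v i) (0≤v j)
witness-nonNeg (plus i j)  0≤v = λ
  { zero                         → nonNeg-+ (0≤v i) (0≤v j)
  ; (suc zero)                   → nonNeg-+ (nonNeg-+ (0≤v i) (0≤v j)) nonNeg-1
  ; (suc (suc zero))             → nonNeg-+ 0≤w nonNeg-1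
  ; (suc (suc (suc zero)))       → 0≤w
  ; (suc (suc (suc (suc zero)))) → nonNeg-+ (0≤v j) nonNeg-1
  }
  where 0≤w = quotient-nonNeg (0≤v i) (0≤v j)

extend-nonNeg : ∀ (s : Step n) {v} → NonNegTuple v → NonNegTuple (extend s v)
extend-nonNeg s 0≤v = ++-nonNeg (witness-nonNeg s 0≤v) 0≤v

extend-solves : ∀ (s : Step n) {v} → NonNegTuple v → All (holds (extend s v)) (equations s)
extend-solves constants   0≤v = refl ∷ refl ∷ []
extend-solves (succ i)    0≤v = refl ∷ []
extend-solves (times i j) 0≤v = refl ∷ []
extend-solves (plus i j) {v} 0≤v = refl ∷ w*y₁≡x ∷ refl ∷ y₁*[w+1]≡x+y+1 ∷ refl ∷ []
  where
  x = v i
  y₁ = v j + 1ℚ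
  w = x * recip y₁
  w*y₁≡x : w * y₁ ≡ x
  w*y₁≡x = recip-inverseʳ x (nonNeg⇒+1≢0 (0≤v j))
  y₁*[w+1]≡x+y+1 : y₁ * (w + 1ℚ) ≡ x + v j + 1ℚ
  y₁*[w+1]≡x+y+1 = begin
    y₁ * (w + 1ℚ)    ≡⟨ solve 2 (λ w y₁ → y₁ :* (w :+ con 1ℚ) := w :* y₁ :+ y₁) refl w y₁ ⟩
    w * y₁ + y₁      ≡⟨ cong (_+ y₁) w*y₁≡x ⟩
    x + (v j + 1ℚ)   ≡⟨ sym (QP.+-assoc x (v j) 1ℚ) ⟩
    x + v j + 1ℚ     ∎
    where open ≡-Reasoning

extend-unique : ∀ (s : Step n) {y} → NonNegTuple y → All (holds y) (equations s) →
                y ≗ extend s (y ∘ (fresh s ↑ʳ_))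
extend-unique constants {y} 0≤y (u*u≡u ∷ z+1≡u ∷ []) = λ
  { zero          → +1-cancel (trans z+1≡u u≡1)
  ; (suc zero)    → u≡1
  ; (suc (suc k)) → refl
  }
  where
  u = y (suc zero)
  u≢0 : u ≢ 0ℚ
  u≢0 u≡0 = nonNeg⇒+1≢0 (0≤y zero) (trans z+1≡u u≡0)
  u≡1 : u ≡ 1ℚ
  u≡1 = begin
    u                  ≡⟨ quotient-unique u≢0 u*u≡u ⟩
    u * recip u        ≡⟨ solve 2 (λ u r → u :* r := con 1ℚ :* r :* u) refl u (recip u) ⟩
    1ℚ * recip u * u   ≡⟨ recip-inverseʳ 1ℚ u≢0 ⟩
    1ℚ                 ∎
    where open ≡-Reasoning
extend-unique (succ i)    0≤y (t≡u+1 ∷ []) = λ { zero → sym t≡u+1 ; (suc k) → refl }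
extend-unique (times i j) 0≤y (t≡u*v ∷ []) = λ { zero → sym t≡u*v ; (suc k) → refl }
extend-unique (plus i j) {y} 0≤y (h₁ ∷ h₂ ∷ h₃ ∷ h₄ ∷ h₅ ∷ []) = λ
  { zero                                → +1-cancel (trans h₅ t₁≡x+y+1)
  ; (suc zero)                          → t₁≡x+y+1
  ; (suc (suc zero))                    → trans (sym h₃) (cong (_+ 1ℚ) t₃≡w)
  ; (suc (suc (suc zero)))              → t₃≡w
  ; (suc (suc (suc (suc zero))))        → sym h₁
  ; (suc (suc (suc (suc (suc k)))))     → refl
  }
  where
  x = y (5 ↑ʳ i)
  y′ = y (5 ↑ʳ j)
  t : Fin 5 → ℚ
  t k = y (k ↑ˡ _)
  t₃≡w : t (# 3) ≡ x * recip (y′ + 1ℚ)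
  t₃≡w = trans (quotient-unique (λ t₄≡0 → nonNeg⇒+1≢0 (0≤y (5 ↑ʳ j)) (trans h₁ t₄≡0)) h₂)
               (cong (λ q → x * recip q) (sym h₁))
  t₁≡x+y+1 : t (# 1) ≡ x + y′ + 1ℚ
  t₁≡x+y+1 = begin
    t (# 1)                      ≡⟨ sym h₄ ⟩
    t₄ * t (# 2)                 ≡⟨ cong (t₄ *_) (sym h₃) ⟩
    t₄ * (t₃ + 1ℚ)               ≡⟨ solve 2 (λ t₃ t₄ → t₄ :* (t₃ :+ con 1ℚ) := t₃ :* t₄ :+ t₄) refl t₃ t₄ ⟩
    t₃ * t₄ + t₄                 ≡⟨ cong₂ _+_ h₂ (sym h₁) ⟩
    x + (y′ + 1ℚ)                ≡⟨ sym (QP.+-assoc x y′ 1ℚ) ⟩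
    x + y′ + 1ℚ                  ∎
    where
    open ≡-Reasoning
    t₃ = t (# 3)
    t₄ = t (# 4)

-- Straight-line programs

infixr 5 _∷_
data Chain (n : ℕ) : ℕ → Set where
  []  : Chain n n
  _∷_ : (s : Step n) → Chain (fresh s N.+ n) m → Chain n m

infixr 5 _++ᶜ_
_++ᶜ_ : Chain n m → Chain m k → Chain n k
[]      ++ᶜ d = d
(s ∷ c) ++ᶜ d = s ∷ (c ++ᶜ d)

infixl 5 _∷ʳ_
_∷ʳ_ : Chain n m → (s : Step m) → Chain n (fresh s N.+ m)
c ∷ʳ s = c ++ᶜ (s ∷ [])

embed : Chain n m → Fin n → Fin m
embed []      i = i
embed (s ∷ c) i = embed c (fresh s ↑ʳ i)

run : Chain n m → (Fin n → ℚ) → Fin m → ℚ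
run []      v = v
run (s ∷ c) v = run c (extend s v)

chainEquations : Chain n m → System m
chainEquations []      = []
chainEquations (s ∷ c) = List.map (rename (embed c)) (equations s) List.++ chainEquations c

run-embed : ∀ (c : Chain n m) v i → run c v (embed c i) ≡ v i
run-embed []      v i = refl
run-embed (s ∷ c) v i = trans (run-embed c (extend s v) (fresh s ↑ʳ i)) (extend-old s v i)

run-cong : ∀ (c : Chain n m) {v v′} → v ≗ v′ → run c v ≗ run c v′
run-cong []      v≗v′ = v≗v′
run-cong (s ∷ c) v≗v′ = run-cong c (extend-cong s v≗v′)

run-++ : ∀ (c : Chain n m) (d : Chain m k) v → run (c ++ᶜ d) v ≗ run d (run c v)
run-++ []      d v i = refl
run-++ (s ∷ c) d v i = run-++ c d (extend s v) i

run-solves : ∀ (c : Chain n m) {v} → NonNegTuple v → SolvesSys (chainEquations c) (run c v)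
run-solves []           0≤v = 0≤v , []
run-solves (s ∷ c) {v} 0≤v =
  proj₁ rest , AllP.++⁺ (AllP.map⁺ (All.map lift (extend-solves s 0≤v))) (proj₂ rest)
  where
  rest = run-solves c (extend-nonNeg s 0≤v)
  lift : ∀ {e} → holds (extend s v) e → holds (run c (extend s v)) (rename (embed c) e)
  lift {e} h = holds-rename⁺ (embed c) e (holds-cong (sym ∘ run-embed c (extend s v)) e h)

run-unique : ∀ (c : Chain n m) {y} → SolvesSys (chainEquations c) y → y ≗ run c (y ∘ embed c)
run-unique []           _ i = refl
run-unique (s ∷ c) {y} (0≤y , hs) i = begin
  y i                                   ≡⟨ run-unique c (0≤y , AllP.++⁻ʳ stepEqs hs) i ⟩
  run c u i                             ≡⟨ run-cong c u-unique i ⟩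
  run c (extend s (u ∘ (fresh s ↑ʳ_))) i ∎
  where
  open ≡-Reasoning
  stepEqs = List.map (rename (embed c)) (equations s)
  u = y ∘ embed c
  u-unique : u ≗ extend s (u ∘ (fresh s ↑ʳ_))
  u-unique = extend-unique s (0≤y ∘ embed c)
    (All.map (λ {e} → holds-rename⁻ (embed c) e) (AllP.map⁻ (AllP.++⁻ˡ stepEqs hs)))

-- Compiling polynomials with natural coefficients

infixl 6 _⊞_
infixl 7 _⊠_
data Expr (p : ℕ) : Set where
  evar  : Fin p → Expr p
  ezero : Expr p
  esuc  : Expr p → Expr p
  _⊞_ _⊠_ : Expr p → Expr p → Expr p

⟦_⟧ : Expr p → (Fin p → ℚ) → ℚ
⟦ evar i ⟧  x = x i
⟦ ezero ⟧   x = 0ℚ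
⟦ esuc e ⟧  x = ⟦ e ⟧ x + 1ℚ
⟦ a ⊞ b ⟧   x = ⟦ a ⟧ x + ⟦ b ⟧ x
⟦ a ⊠ b ⟧   x = ⟦ a ⟧ x * ⟦ b ⟧ x

⟦⟧-cong : ∀ (e : Expr p) {x x′} → x ≗ x′ → ⟦ e ⟧ x ≡ ⟦ e ⟧ x′
⟦⟧-cong (evar i) x≗x′ = x≗x′ i
⟦⟧-cong ezero    x≗x′ = refl
⟦⟧-cong (esuc e) x≗x′ = cong (_+ 1ℚ) (⟦⟧-cong e x≗x′)
⟦⟧-cong (a ⊞ b)  x≗x′ = cong₂ _+_ (⟦⟧-cong a x≗x′) (⟦⟧-cong b x≗x′)
⟦⟧-cong (a ⊠ b)  x≗x′ = cong₂ _*_ (⟦⟧-cong a x≗x′) (⟦⟧-cong b x≗x′)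

record Compiled (m : ℕ) : Set where
  constructor compiled
  field
    {width} : ℕ
    chain   : Chain m width
    output  : Fin width

record Compiled₂ (m : ℕ) : Set where
  constructor compiled₂
  field
    {width}     : ℕ
    chain       : Chain m width
    left right  : Fin width

open Compiled using (chain; output)
open Compiled₂ renaming (width to width₂; chain to chain₂)

-- env locates the variables of the expression and z a variable holding 0.
mutual
  compile : Expr p → (Fin p → Fin m) → Fin m → Compiled m
  compile (evar i) env z = compiled [] (env i)
  compile ezero    env z = compiled [] z
  compile (esuc e) env z = let C = compile e env z in compiled (chain C ∷ʳ succ (output C)) zero
  compile (a ⊞ b)  env z = let B = operands a b env z in compiled (chain₂ B ∷ʳ plus (left B) (right B)) zero
  compile (a ⊠ b)  env z = let B = operands a b env z in compiled (chain₂ B ∷ʳ times (left B) (right B)) zero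

  operands : Expr p → Expr p → (Fin p → Fin m) → Fin m → Compiled₂ m
  operands a b env z = compiled₂ (chain A ++ᶜ chain B) (embed (chain B) (output A)) (output B)
    where
    A = compile a env z
    B = compile b (embed (chain A) ∘ env) (embed (chain A) z)

mutual
  compile-correct : ∀ (e : Expr p) (env : Fin p → Fin m) z {v} → v z ≡ 0ℚ →
                    run (chain (compile e env z)) v (output (compile e env z)) ≡ ⟦ e ⟧ (v ∘ env)
  compile-correct (evar i) env z vz≡0 = refl
  compile-correct ezero    env z vz≡0 = vz≡0
  compile-correct (esuc e) env z {v} vz≡0 =
    trans (run-++ (chain C) _ v zero) (cong (_+ 1ℚ) (compile-correct e env z vz≡0))
    where C = compile e env z
  compile-correct (a ⊞ b)  env z {v} vz≡0 =
    trans (run-++ (chain₂ (operands a b env z)) _ v zero)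
          (uncurry (cong₂ _+_) (operands-correct a b env z vz≡0))
  compile-correct (a ⊠ b)  env z {v} vz≡0 =
    trans (run-++ (chain₂ (operands a b env z)) _ v zero)
          (uncurry (cong₂ _*_) (operands-correct a b env z vz≡0))

  operands-correct : ∀ (a b : Expr p) (env : Fin p → Fin m) z {v} → v z ≡ 0ℚ →
                     let B = operands a b env z in
                     run (chain₂ B) v (left B) ≡ ⟦ a ⟧ (v ∘ env)
                     × run (chain₂ B) v (right B) ≡ ⟦ b ⟧ (v ∘ env)
  operands-correct a b env z {v} vz≡0 = left≡ , right≡
    where
    open ≡-Reasoning
    A = compile a env z
    B = compile b (embed (chain A) ∘ env) (embed (chain A) z)
    w = run (chain A) v
    left≡ : run (chain A ++ᶜ chain B) v (embed (chain B) (output A)) ≡ ⟦ a ⟧ (v ∘ env)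
    left≡ = begin
      run (chain A ++ᶜ chain B) v (embed (chain B) (output A))  ≡⟨ run-++ (chain A) (chain B) v _ ⟩
      run (chain B) w (embed (chain B) (output A))             ≡⟨ run-embed (chain B) w (output A) ⟩
      w (output A)                                             ≡⟨ compile-correct a env z vz≡0 ⟩
      ⟦ a ⟧ (v ∘ env)                                          ∎
    right≡ : run (chain A ++ᶜ chain B) v (output B) ≡ ⟦ b ⟧ (v ∘ env)
    right≡ = begin
      run (chain A ++ᶜ chain B) v (output B)  ≡⟨ run-++ (chain A) (chain B) v _ ⟩
      run (chain B) w (output B)             ≡⟨ compile-correct b _ _ (trans (run-embed (chain A) v z) vz≡0) ⟩
      ⟦ b ⟧ (w ∘ embed (chain A) ∘ env)       ≡⟨ ⟦⟧-cong b (run-embed (chain A) v ∘ env) ⟩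
      ⟦ b ⟧ (v ∘ env)                         ∎

natExpr : ℕ → Expr p
natExpr N.zero    = ezero
natExpr (N.suc k) = esuc (natExpr k)

⟦natExpr⟧ : ∀ k (x : Fin p → ℚ) → ⟦ natExpr k ⟧ x ≡ + k / 1
⟦natExpr⟧ N.zero    x = refl
⟦natExpr⟧ (N.suc k) x = trans (cong (_+ 1ℚ) (⟦natExpr⟧ k x)) (sym (fromℕ-suc k))

mutual
  positivePart negativePart : Poly p → Expr p
  positivePart (con (+ k))    = natExpr k
  positivePart (con -[1+ k ]) = ezero
  positivePart (var i)        = evar i
  positivePart (a ⊕ b)        = positivePart a ⊞ positivePart b
  positivePart (a ⊗ b)        = positivePart a ⊠ positivePart b ⊞ negativePart a ⊠ negativePart b

  negativePart (con (+ k))    = ezero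
  negativePart (con -[1+ k ]) = natExpr (N.suc k)
  negativePart (var i)        = ezero
  negativePart (a ⊕ b)        = negativePart a ⊞ negativePart b
  negativePart (a ⊗ b)        = positivePart a ⊠ negativePart b ⊞ negativePart a ⊠ positivePart b

eval≡positive-negative : ∀ (D : Poly p) x → eval D x ≡ ⟦ positivePart D ⟧ x - ⟦ negativePart D ⟧ x
eval≡positive-negative (con (+ k)) x =
  trans (sym (⟦natExpr⟧ k x)) (solve 1 (λ a → a := a :- con 0ℚ) refl _)
eval≡positive-negative (con -[1+ k ]) x =
  trans (cong -_ (sym (⟦natExpr⟧ (N.suc k) x))) (solve 1 (λ a → :- a := con 0ℚ :- a) refl _)
eval≡positive-negative (var i) x = solve 1 (λ a → a := a :- con 0ℚ) refl (x i)
eval≡positive-negative (a ⊕ b) x =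
  trans (cong₂ _+_ (eval≡positive-negative a x) (eval≡positive-negative b x))
    (solve 4 (λ a⁺ a⁻ b⁺ b⁻ → (a⁺ :- a⁻) :+ (b⁺ :- b⁻) := (a⁺ :+ b⁺) :- (a⁻ :+ b⁻)) refl
      (⟦ positivePart a ⟧ x) (⟦ negativePart a ⟧ x) (⟦ positivePart b ⟧ x) (⟦ negativePart b ⟧ x))
eval≡positive-negative (a ⊗ b) x =
  trans (cong₂ _*_ (eval≡positive-negative a x) (eval≡positive-negative b x))
    (solve 4 (λ a⁺ a⁻ b⁺ b⁻ → (a⁺ :- a⁻) :* (b⁺ :- b⁻)
                            := (a⁺ :* b⁺ :+ a⁻ :* b⁻) :- (a⁺ :* b⁻ :+ a⁻ :* b⁺)) refl
      (⟦ positivePart a ⟧ x) (⟦ negativePart a ⟧ x) (⟦ positivePart b ⟧ x) (⟦ negativePart b ⟧ x))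

-- Encoding a predicate by a system S ⊆ G_n

record Encoding (P : (Fin p → ℚ) → Set) : Set where
  field
    width               : ℕ
    width-pos           : 1 ≤ width
    system              : System width
    position            : Fin p → Fin width
    solution            : (Fin p → ℚ) → Fin width → ℚ
    solution-position   : ∀ x i → solution x (position i) ≡ x i
    solution-cong       : ∀ {x x′} → x ≗ x′ → solution x ≗ solution x′
    solution-solves     : ∀ {x} → P x → SolvesSys system (solution x)
    solves⇒restriction  : ∀ {y} → SolvesSys system y → P (y ∘ position) × y ≗ solution (y ∘ position)

hℚ≤height : ∀ (y : Fin m → ℚ) i → hℚ (y i) ≤ height y
hℚ≤height y zero    = NP.m≤m⊔n _ _
hℚ≤height y (suc i) = NP.≤-trans (hℚ≤height (y ∘ suc) i) (NP.m≤n⊔m _ _)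

height-reindex-≤ : ∀ (x : Fin p → ℚ) (y : Fin m → ℚ) (ρ : Fin p → Fin m) →
                   x ≗ y ∘ ρ → height x ≤ height y
height-reindex-≤ {N.zero}  x y ρ x≗y∘ρ = N.z≤n
height-reindex-≤ {N.suc p} x y ρ x≗y∘ρ =
  NP.⊔-lub (subst (λ q → hℚ q ≤ height y) (sym (x≗y∘ρ zero)) (hℚ≤height y (ρ zero)))
           (height-reindex-≤ (x ∘ suc) y (ρ ∘ suc) (x≗y∘ρ ∘ suc))

module _ {P : (Fin p → ℚ) → Set} (E : Encoding P) where
  open Encoding E

  finitelyMany-encoding : FinitelyMany P → FinitelyMany (SolvesSys system)
  finitelyMany-encoding (L , cover) = List.map solution L , λ y sol →
    let (P[y∘position] , y≗) = solves⇒restriction sol in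
    AnyP.map⁺ (Any.map (λ x≗z i → trans (y≗ i) (solution-cong x≗z i)) (cover (y ∘ position) P[y∘position]))

  encoding-height-bound : Conjecture2 → FinitelyMany P → ∀ x → P x → height x ≤ f (2 N.* width)
  encoding-height-bound conjecture finite x Px = NP.≤-trans
    (height-reindex-≤ x (solution x) position (sym ∘ solution-position x))
    (conjecture width width-pos system (finitelyMany-encoding finite) (solution x) (solution-solves Px))

module _ (D : Poly p) where
  private
    B = operands (positivePart D) (negativePart D) (2 ↑ʳ_) zero
    c : Chain p (width₂ B)
    c = constants ∷ chain₂ B
    one = embed (chain₂ B) (suc zero)
    balance : GEq (width₂ B)
    balance = mul (left B) one (right B)

    run-balance : ∀ x → run c x (left B) * run c x one ≡ ⟦ positivePart D ⟧ x
                      × run c x (right B) ≡ ⟦ negativePart D ⟧ x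
    run-balance x =
        trans (cong₂ _*_ (proj₁ values) (run-embed (chain₂ B) (extend constants x) (suc zero))) (QP.*-identityʳ _)
      , proj₂ values
      where values = operands-correct (positivePart D) (negativePart D) (2 ↑ʳ_) zero {extend constants x} refl

    dio⇒balance : ∀ {x} → eval D x ≡ 0ℚ → holds (run c x) balance
    dio⇒balance {x} D≡0 = begin
      run c x (left B) * run c x one   ≡⟨ proj₁ (run-balance x) ⟩
      ⟦ positivePart D ⟧ x             ≡⟨ x∙y⁻¹≈ε⇒x≈y _ _ (trans (sym (eval≡positive-negative D x)) D≡0) ⟩
      ⟦ negativePart D ⟧ x             ≡⟨ sym (proj₂ (run-balance x)) ⟩
      run c x (right B)                ∎
      where open ≡-Reasoning

    balance⇒dio : ∀ {x} → holds (run c x) balance → eval D x ≡ 0ℚ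
    balance⇒dio {x} h = begin
      eval D x                                      ≡⟨ eval≡positive-negative D x ⟩
      ⟦ positivePart D ⟧ x - ⟦ negativePart D ⟧ x   ≡⟨ x≈y⇒x∙y⁻¹≈ε P≡N ⟩
      0ℚ                                            ∎
      where
      open ≡-Reasoning
      P≡N = trans (sym (proj₁ (run-balance x))) (trans h (proj₂ (run-balance x)))

  dioEncoding : Encoding (SolvesDio D)
  dioEncoding = record
    { width              = width₂ B
    ; width-pos          = N.>-nonZero⁻¹ _ {{nonZeroIndex one}}
    ; system             = balance ∷ chainEquations c
    ; position           = embed c
    ; solution           = run c
    ; solution-position  = run-embed c
    ; solution-cong      = run-cong c
    ; solution-solves    = λ (0≤x , D≡0) → let (0≤r , hs) = run-solves c 0≤x in
                             0≤r , dio⇒balance D≡0 ∷ hs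
    ; solves⇒restriction = λ { (0≤y , hb ∷ hs) → let y≗ = run-unique c (0≤y , hs) in
                               (0≤y ∘ embed c , balance⇒dio (holds-cong y≗ balance hb)) , y≗ }
    }

theorem6 : Conjecture2 →
    Σ ((p : ℕ) → Poly p → ℕ) λ B →
      (p : ℕ) (D : Poly p) → FinitelyMany (SolvesDio D) →
        (x : Fin p → ℚ) → SolvesDio D x → height x ≤ B p D
theorem6 conjecture =
  (λ p D → f (2 N.* Encoding.width (dioEncoding D))) ,
  (λ p D → encoding-height-bound (dioEncoding D) conjecture)
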